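{- Let $d\ge1$ and $r\ge3$ be integers and let $z$ be an integer with $2\le z\le r-1$. Then $|V(z)|\ge 2^{d(z-1)}\left(1-2z^{1-d\log z}\right)$.
   Context: $\log$ denotes $\log_2$ and $\log^2 z=(\log_2 z)^2$. For $\mathbf c=(c_{d+1},c_{d+2},\dots,c_{dz})\in\mathbb Z_2^{d(z-1)}$ (coordinates indexed by $d+1,\dots,dz$), let $s=\|\mathbf c\|$ be its Hamming weight, let $j_1<\dots<j_s$ be the indices with $c_{j}=1$, and let $\hat w_{\mathbf c}=(w_0,w_1,\dots,w_s,w_{s+1})$ with $w_0=0$, $w_{s+1}=z$ and $w_i=\lfloor (j_i-1)/d\rfloor$ for $1\le i\le s$ (so $1\le w_1\le\dots\le w_s\le z-1$ and $j_i\in\{dw_i+1,\dots,dw_i+d\}$). Define $V(z)=\{\mathbf c\in\mathbb Z_2^{d(z-1)}:\max_{0\le i\le s}(w_{i+1}-w_i)\le\lceil\log^2 z\rceil\}$. -}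

module Defs where

open import Data.Bool using (Bool; true; false; _∧_)
open import Data.Nat using (ℕ; zero; suc; _+_; _*_; _∸_; _^_; _≤_; _<_; _≤ᵇ_; NonZero)
open import Data.Nat.DivMod using (_/_)
open import Data.List using (List; []; _∷_; _++_; map; length; filterᵇ; [_])
open import Data.Vec using (Vec; []; _∷_)
open import Data.Product using (∃₂; _×_)
open import Data.Sum using (_⊎_)
open import Relation.Binary.PropositionalEquality using (_≡_)

-- A vector c ∈ Z_2^{d(z-1)} is a Vec Bool (d * (z ∸ 1)); position k (0-based)
-- corresponds to the paper's index j = d + 1 + k.

positionsFrom : ∀ {n} → ℕ → Vec Bool n → List ℕ
positionsFrom i [] = []
positionsFrom i (true ∷ c) = i ∷ positionsFrom (suc i) c
positionsFrom i (false ∷ c) = positionsFrom (suc i) c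

positions : ∀ {n} → Vec Bool n → List ℕ
positions = positionsFrom 0

-- w_i = ⌊(j_i - 1)/d⌋ with j_i = d + 1 + k_i, i.e. ⌊(d + k_i)/d⌋.
weights : (d : ℕ) .{{_ : NonZero d}} → ∀ {n} → Vec Bool n → List ℕ
weights d c = map (λ k → (d + k) / d) (positions c)

what : (d : ℕ) .{{_ : NonZero d}} → ℕ → ∀ {n} → Vec Bool n → List ℕ
what d z c = 0 ∷ (weights d c ++ [ z ])

gaps : List ℕ → List ℕ
gaps (x ∷ y ∷ r) = (y ∸ x) ∷ gaps (y ∷ r)
gaps _ = []

allLeᵇ : ℕ → List ℕ → Bool
allLeᵇ L [] = true
allLeᵇ L (g ∷ gs) = (g ≤ᵇ L) ∧ allLeᵇ L gs

-- membership in V(z), where L plays the role of ⌈log² z⌉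
inV : (d : ℕ) .{{_ : NonZero d}} → (z L : ℕ) → Vec Bool (d * (z ∸ 1)) → Bool
inV d z L c = allLeᵇ L (gaps (what d z c))

allVecs : (n : ℕ) → List (Vec Bool n)
allVecs zero = [] ∷ []
allVecs (suc n) = map (true ∷_) (allVecs n) ++ map (false ∷_) (allVecs n)

cardV : (d : ℕ) .{{_ : NonZero d}} → (z L : ℕ) → ℕ
cardV d z L = length (filterᵇ (inV d z L) (allVecs (d * (z ∸ 1))))

-- L = ⌈(log₂ z)²⌉, characterised with rationals n/m approximating log₂ z from below:
--   (i)  (log₂ z)² ≤ L      ⇔ ∀ n m (m ≥ 1), 2^n ≤ z^m → n² ≤ L m²
--   (ii) (log₂ z)² > L - 1  ⇔ L = 0 or ∃ n m (m ≥ 1), 2^n ≤ z^m and n² > (L-1) m²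
IsCeilLogSq : ℕ → ℕ → Set
IsCeilLogSq z L =
  (∀ n m → 1 ≤ m → 2 ^ n ≤ z ^ m → n * n ≤ L * (m * m))
  × (L ≡ 0 ⊎ ∃₂ λ n m → 1 ≤ m × 2 ^ n ≤ z ^ m × (L ∸ 1) * (m * m) < n * n)

{-# OPTIONS --safe #-}
-- If c lies outside V(z), some gap of the nondecreasing sequence ŵ_c exceeds L = ⌈log² z⌉, so for
-- some t with t + L < z no weight lies in (t, t + L]: c vanishes on the d L coordinates
-- d t, …, d t + d L − 1.  Each of the at most z choices of t is met by 2^(d(z−1) − dL) vectors, and the
-- union bound gives |Z₂^(d(z−1)) ∖ V(z)| · 2^(dL) ≤ z · 2^(d(z−1)).  The statement expresses
-- 2^(−d log² z) through rationals n/m ≤ log z, for which n² ≤ L m², so raising this bound to the power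
-- m² gives the claim.

module Submission where

open import Defs
open import Data.Bool using (Bool; true; false; _∧_; not; T)
open import Data.Bool.Properties using (T-∧)
open import Data.List using (List; []; _∷_; _++_; map; length; filterᵇ; [_])
open import Data.Vec using (Vec; []; _∷_)
open import Data.List.Properties using (length-++; length-map; filter-++; filter-all; filter-none)
open import Data.List.Relation.Unary.All as All using (All; []; _∷_)
import Data.List.Relation.Unary.All.Properties as Allₚ
open import Data.List.Relation.Unary.AllPairs as AllPairs using (AllPairs; []; _∷_)
import Data.List.Relation.Unary.AllPairs.Properties as AllPairsₚ
open import Data.Nat
open import Data.Nat.Properties
open import Data.Nat.DivMod using (_/_; /-monoˡ-≤; m*n/n≡m; m<n*o⇒m/o<n)
open import Algebra.Properties.CommutativeSemigroup *-commutativeSemigroup using (interchange; x∙yz≈y∙xz)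
open import Data.Sum using (_⊎_; inj₁; inj₂)
open import Data.Product using (∃-syntax; _×_; _,_)
open import Data.Unit using (tt)
open import Function using (_∘_; Equivalence)
open import Relation.Nullary using (¬_; contradiction)
open import Relation.Nullary.Decidable using (T?)
open import Relation.Nullary.Reflects using (ofⁿ)
open import Relation.Binary.PropositionalEquality using (_≡_; refl; sym; trans; cong; cong₂; subst; module ≡-Reasoning)

private
  variable
    A B : Set

T-not⇒¬T : ∀ {b} → T (not b) → ¬ T b
T-not⇒¬T {true} ()
T-not⇒¬T {false} _ ()

count : (A → Bool) → List A → ℕ
count p xs = length (filterᵇ p xs)

count-++ : (p : A → Bool) (xs ys : List A) → count p (xs ++ ys) ≡ count p xs + count p ys
count-++ p xs ys = trans (cong length (filter-++ (T? ∘ p) xs ys)) (length-++ (filterᵇ p xs))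

count-map : (p : B → Bool) (f : A → B) (xs : List A) → count p (map f xs) ≡ count (p ∘ f) xs
count-map p f [] = refl
count-map p f (x ∷ xs) with p (f x)
... | true = cong suc (count-map p f xs)
... | false = count-map p f xs

count-complement : (p : A → Bool) (xs : List A) → count p xs + count (not ∘ p) xs ≡ length xs
count-complement p [] = refl
count-complement p (x ∷ xs) with p x
... | true = cong suc (count-complement p xs)
... | false = trans (+-suc (count p xs) _) (cong suc (count-complement p xs))

count-none : (p : A → Bool) (xs : List A) → (∀ x → ¬ T (p x)) → count p xs ≡ 0
count-none p xs ¬p = cong length (filter-none (T? ∘ p) (All.universal ¬p xs))

count-≤-∧-not-+ : (p q : A → Bool) (xs : List A) →
  count p xs ≤ count (λ x → p x ∧ not (q x)) xs + count q xs
count-≤-∧-not-+ p q [] = z≤n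
count-≤-∧-not-+ p q (x ∷ xs) with p x | q x | count-≤-∧-not-+ p q xs
... | true  | true  | ih = ≤-trans (s≤s ih) (≤-reflexive (sym (+-suc _ _)))
... | true  | false | ih = s≤s ih
... | false | true  | ih = ≤-trans (m≤n⇒m≤1+n ih) (≤-reflexive (sym (+-suc _ _)))
... | false | false | ih = ih

-- The union bound, with all counts scaled by K.
count-cover : (p : A → Bool) (q : ℕ → A → Bool) (xs : List A) {K M : ℕ} (s : ℕ) →
  (∀ x → T (p x) → ∃[ t ] t < s × T (q t x)) →
  (∀ t → t < s → count (q t) xs * K ≤ M) →
  count p xs * K ≤ s * M
count-cover p q xs zero cover _ = ≤-reflexive (cong (_* _) (count-none p xs uncovered))
  where
  uncovered : ∀ x → ¬ T (p x)
  uncovered x px with cover x px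
  ... | _ , () , _
count-cover p q xs {K} {M} (suc s) cover bound = begin
  count p xs * K                        ≤⟨ *-monoˡ-≤ K (count-≤-∧-not-+ p (q s) xs) ⟩
  (count p′ xs + count (q s) xs) * K    ≡⟨ *-distribʳ-+ K (count p′ xs) _ ⟩
  count p′ xs * K + count (q s) xs * K  ≤⟨ +-mono-≤ (count-cover p′ q xs s cover′ bound′) (bound s ≤-refl) ⟩
  s * M + M                             ≡⟨ +-comm (s * M) M ⟩
  suc s * M                             ∎
  where
  open ≤-Reasoning
  p′ : _ → Bool
  p′ x = p x ∧ not (q s x)
  cover′ : ∀ x → T (p′ x) → ∃[ t ] t < s × T (q t x)
  cover′ x p′x with Equivalence.to T-∧ p′x
  ... | px , ¬qsx with cover x px
  ... | t , t<1+s , qtx with m≤n⇒m<n∨m≡n (s≤s⁻¹ t<1+s)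
  ...   | inj₁ t<s  = t , t<s , qtx
  ...   | inj₂ refl = contradiction qtx (T-not⇒¬T ¬qsx)
  bound′ : ∀ t → t < s → count (q t) xs * K ≤ M
  bound′ t t<s = bound t (m≤n⇒m≤1+n t<s)

length-allVecs : ∀ n → length (allVecs n) ≡ 2 ^ n
length-allVecs zero = refl
length-allVecs (suc n) = begin
  length (map (true ∷_) (allVecs n) ++ map (false ∷_) (allVecs n))
    ≡⟨ length-++ (map (true ∷_) (allVecs n)) ⟩
  length (map (true ∷_) (allVecs n)) + length (map (false ∷_) (allVecs n))
    ≡⟨ cong₂ _+_ (length-map (true ∷_) (allVecs n)) (length-map (false ∷_) (allVecs n)) ⟩
  length (allVecs n) + length (allVecs n)
    ≡⟨ cong (λ l → l + l) (length-allVecs n) ⟩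
  2 ^ n + 2 ^ n
    ≡⟨ cong (2 ^ n +_) (sym (+-identityʳ (2 ^ n))) ⟩
  2 ^ suc n ∎
  where open ≡-Reasoning

count-allVecs-suc : ∀ n (p : Vec Bool (suc n) → Bool) →
  count p (allVecs (suc n)) ≡ count (p ∘ (true ∷_)) (allVecs n) + count (p ∘ (false ∷_)) (allVecs n)
count-allVecs-suc n p = trans (count-++ p (map (true ∷_) (allVecs n)) _)
  (cong₂ _+_ (count-map p (true ∷_) (allVecs n)) (count-map p (false ∷_) (allVecs n)))

-- c is 0 at those of the positions a, a + 1, …, a + w − 1 that exist.
zeroOn : ∀ {n} → ℕ → ℕ → Vec Bool n → Bool
zeroOn zero    zero    c       = true
zeroOn _       _       []      = true
zeroOn zero    (suc w) (b ∷ c) = not b ∧ zeroOn zero w c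
zeroOn (suc a) w       (_ ∷ c) = zeroOn a w c

count-zeroOn : ∀ a w n → a + w ≤ n → count (zeroOn a w) (allVecs n) * 2 ^ w ≡ 2 ^ n
count-zeroOn zero zero n _ = begin
  count (λ _ → true) (allVecs n) * 1 ≡⟨ *-identityʳ _ ⟩
  count (λ _ → true) (allVecs n)     ≡⟨ cong length (filter-all (T? ∘ λ _ → true) (All.universal _ (allVecs n))) ⟩
  length (allVecs n)                 ≡⟨ length-allVecs n ⟩
  2 ^ n ∎
  where open ≡-Reasoning
count-zeroOn zero (suc w) (suc n) (s≤s w≤n) = begin
  count (zeroOn 0 (suc w)) (allVecs (suc n)) * (2 * 2 ^ w)
    ≡⟨ cong (_* (2 * 2 ^ w)) (count-allVecs-suc n (zeroOn 0 (suc w))) ⟩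
  (count (λ _ → false) (allVecs n) + C) * (2 * 2 ^ w)
    ≡⟨ cong (λ k → (k + C) * (2 * 2 ^ w)) (count-none _ (allVecs n) (λ _ ())) ⟩
  C * (2 * 2 ^ w) ≡⟨ x∙yz≈y∙xz C 2 (2 ^ w) ⟩
  2 * (C * 2 ^ w) ≡⟨ cong (2 *_) (count-zeroOn zero w n w≤n) ⟩
  2 ^ suc n ∎
  where
  open ≡-Reasoning
  C = count (zeroOn 0 w) (allVecs n)
count-zeroOn (suc a) w (suc n) (s≤s a+w≤n) = begin
  count (zeroOn (suc a) w) (allVecs (suc n)) * 2 ^ w
    ≡⟨ cong (_* 2 ^ w) (count-allVecs-suc n (zeroOn (suc a) w)) ⟩
  (C + C) * 2 ^ w     ≡⟨ cong (λ k → (C + k) * 2 ^ w) (sym (+-identityʳ C)) ⟩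
  2 * C * 2 ^ w       ≡⟨ *-assoc 2 C (2 ^ w) ⟩
  2 * (C * 2 ^ w)     ≡⟨ cong (2 *_) (count-zeroOn a w n a+w≤n) ⟩
  2 ^ suc n ∎
  where
  open ≡-Reasoning
  C = count (zeroOn a w) (allVecs n)

positionsFrom-suc : ∀ {n} i (c : Vec Bool n) → positionsFrom (suc i) c ≡ map suc (positionsFrom i c)
positionsFrom-suc i [] = refl
positionsFrom-suc i (true ∷ c) = cong (suc i ∷_) (positionsFrom-suc (suc i) c)
positionsFrom-suc i (false ∷ c) = positionsFrom-suc (suc i) c

All-positions-∷⁻ : ∀ {P : ℕ → Set} {n} b (c : Vec Bool n) →
  All P (positions (b ∷ c)) → All (P ∘ suc) (positions c)
All-positions-∷⁻ {P} true c (_ ∷ ps) = Allₚ.map⁻ (subst (All P) (positionsFrom-suc 0 c) ps)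
All-positions-∷⁻ {P} false c ps = Allₚ.map⁻ (subst (All P) (positionsFrom-suc 0 c) ps)

zeroOn-intro : ∀ {n} a w (c : Vec Bool n) → All (λ k → k < a ⊎ a + w ≤ k) (positions c) → T (zeroOn a w c)
zeroOn-intro zero    zero    c           _              = tt
zeroOn-intro zero    (suc w) []          _              = tt
zeroOn-intro (suc a) w       []          _              = tt
zeroOn-intro zero    (suc w) (true ∷ c)  (inj₁ () ∷ _)
zeroOn-intro zero    (suc w) (true ∷ c)  (inj₂ () ∷ _)
zeroOn-intro zero    (suc w) (false ∷ c) k∉ = zeroOn-intro zero w c (All.map shift (All-positions-∷⁻ false c k∉))
  where
  shift : ∀ {k} → suc k < 0 ⊎ suc w ≤ suc k → k < 0 ⊎ w ≤ k
  shift (inj₂ w<k) = inj₂ (s≤s⁻¹ w<k)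
zeroOn-intro (suc a) w       (b ∷ c)     k∉ = zeroOn-intro a w c (All.map shift (All-positions-∷⁻ b c k∉))
  where
  shift : ∀ {k} → suc k < suc a ⊎ suc a + w ≤ suc k → k < a ⊎ a + w ≤ k
  shift (inj₁ k<a) = inj₁ (s<s⁻¹ k<a)
  shift (inj₂ a+w≤k) = inj₂ (s≤s⁻¹ a+w≤k)

positions-sorted : ∀ {n} (c : Vec Bool n) → AllPairs _≤_ (positions c)
positions-sorted [] = []
positions-sorted (true ∷ c) rewrite positionsFrom-suc 0 c =
  Allₚ.map⁺ (All.universal (λ _ → z≤n) (positions c)) ∷ AllPairsₚ.map⁺ (AllPairs.map s≤s (positions-sorted c))
positions-sorted (false ∷ c) rewrite positionsFrom-suc 0 c =
  AllPairsₚ.map⁺ (AllPairs.map s≤s (positions-sorted c))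

positions-< : ∀ {n} (c : Vec Bool n) → All (_< n) (positions c)
positions-< [] = []
positions-< (true ∷ c) rewrite positionsFrom-suc 0 c = z<s ∷ Allₚ.map⁺ (All.map s<s (positions-< c))
positions-< (false ∷ c) rewrite positionsFrom-suc 0 c = Allₚ.map⁺ (All.map s<s (positions-< c))

<∸⇒+< : ∀ x {L z} → L < z ∸ x → x + L < z
<∸⇒+< zero h = h
<∸⇒+< (suc x) {z = suc z} h = s<s (<∸⇒+< x h)

large-gap⇒empty-interval : ∀ {L z} x ws → AllPairs _≤_ (x ∷ ws) → All (_≤ z) ws →
  ¬ T (allLeᵇ L (gaps (x ∷ ws ++ [ z ]))) →
  ∃[ t ] x ≤ t × t + L < z × All (λ w → w ≤ t ⊎ t + L < w) ws
large-gap⇒empty-interval {L} {z} x [] _ _ ¬small with z ∸ x ≤ᵇ L | ≤ᵇ-reflects-≤ (z ∸ x) L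
... | true  | _ = contradiction tt ¬small
... | false | ofⁿ gap = x , ≤-refl , <∸⇒+< x (≰⇒> gap) , []
large-gap⇒empty-interval {L} {z} x (w ∷ ws) ((x≤w ∷ _) ∷ sorted) (w≤z ∷ ws≤z) ¬small
  with w ∸ x ≤ᵇ L | ≤ᵇ-reflects-≤ (w ∸ x) L
... | false | ofⁿ gap =
  x , ≤-refl , <-≤-trans x+L<w w≤z , inj₂ x+L<w ∷ All.map (inj₂ ∘ <-≤-trans x+L<w) (AllPairs.head sorted)
  where
  x+L<w : x + L < w
  x+L<w = <∸⇒+< x (≰⇒> gap)
... | true  | _ with large-gap⇒empty-interval w ws sorted ws≤z ¬small
... | t , w≤t , t+L<z , ws∉ = t , ≤-trans x≤w w≤t , t+L<z , inj₁ w≤t ∷ ws∉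

module _ (d : ℕ) .{{_ : NonZero d}} where

  weight : ℕ → ℕ
  weight k = (d + k) / d

  weight-mono : ∀ {k l} → k ≤ l → weight k ≤ weight l
  weight-mono k≤l = /-monoˡ-≤ d (+-monoʳ-≤ d k≤l)

  d*t≤k⇒t<weight : ∀ {t k} → d * t ≤ k → t < weight k
  d*t≤k⇒t<weight {t} {k} d*t≤k = begin
    suc t           ≡⟨ m*n/n≡m (suc t) d ⟨
    suc t * d / d   ≤⟨ /-monoˡ-≤ d (+-monoʳ-≤ d (≤-trans (≤-reflexive (*-comm t d)) d*t≤k)) ⟩
    weight k        ∎
    where open ≤-Reasoning

  k<d*u⇒weight≤u : ∀ {k u} → k < d * u → weight k ≤ u
  k<d*u⇒weight≤u {k} {u} k<d*u = s≤s⁻¹ (m<n*o⇒m/o<n (+-monoʳ-< d (<-≤-trans k<d*u (≤-reflexive (*-comm d u)))))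

  -- weight k = 1 + ⌊k / d⌋, so a weight lies in (t, t + L] iff the position k lies in [d t, d t + d L).
  weight∉⇒position∉ : ∀ {t L k} → weight k ≤ t ⊎ t + L < weight k → k < d * t ⊎ d * t + d * L ≤ k
  weight∉⇒position∉ (inj₁ w≤t) = inj₁ (≰⇒> λ d*t≤k → <⇒≱ (d*t≤k⇒t<weight d*t≤k) w≤t)
  weight∉⇒position∉ {t} {L} {k} (inj₂ t+L<w) = inj₂ (≮⇒≥ λ k<d*t+d*L →
    <⇒≱ t+L<w (k<d*u⇒weight≤u (<-≤-trans k<d*t+d*L (≤-reflexive (sym (*-distribˡ-+ d t L))))))

  ∉V⇒zeroOn : ∀ z L (c : Vec Bool (d * (z ∸ 1))) → ¬ T (inV d z L c) →
    ∃[ t ] t + L < z × T (zeroOn (d * t) (d * L) c)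
  ∉V⇒zeroOn z L c ∉V
    with large-gap⇒empty-interval 0 (weights d c) (All.universal (λ _ → z≤n) _ ∷ sorted) bounded ∉V
    where
    sorted : AllPairs _≤_ (weights d c)
    sorted = AllPairsₚ.map⁺ (AllPairs.map weight-mono (positions-sorted c))
    bounded : All (_≤ z) (weights d c)
    bounded = Allₚ.map⁺ (All.map (λ k<N → ≤-trans (k<d*u⇒weight≤u k<N) (m∸n≤m z 1)) (positions-< c))
  ... | t , _ , t+L<z , ws∉ =
    t , t+L<z , zeroOn-intro (d * t) (d * L) c (All.map weight∉⇒position∉ (Allₚ.map⁻ ws∉))

∁V-bound : ∀ d .{{_ : NonZero d}} z L →
  count (not ∘ inV d z L) (allVecs (d * (z ∸ 1))) * 2 ^ (d * L) ≤ (z ∸ L) * 2 ^ (d * (z ∸ 1))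
∁V-bound d z L = count-cover (not ∘ inV d z L) (λ t → zeroOn (d * t) (d * L)) (allVecs N) (z ∸ L) cover bound
  where
  N = d * (z ∸ 1)
  cover : ∀ c → T (not (inV d z L c)) → ∃[ t ] t < z ∸ L × T (zeroOn (d * t) (d * L) c)
  cover c ∉V with ∉V⇒zeroOn d z L c (T-not⇒¬T ∉V)
  ... | t , t+L<z , zeros = t , m+n≤o⇒m≤o∸n (suc t) t+L<z , zeros
  bound : ∀ t → t < z ∸ L → count (zeroOn (d * t) (d * L)) (allVecs N) * 2 ^ (d * L) ≤ 2 ^ N
  bound t t<z∸L = ≤-reflexive (count-zeroOn (d * t) (d * L) N window)
    where
    open ≤-Reasoning
    window : d * t + d * L ≤ N
    window = begin
      d * t + d * L ≡⟨ +-comm (d * t) (d * L) ⟩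
      d * L + d * t ≡⟨ *-distribˡ-+ d L t ⟨
      d * (L + t)   ≤⟨ *-monoʳ-≤ d (<⇒≤pred (<∸⇒+< L t<z∸L)) ⟩
      N             ∎

2^N∸cardV≡count∁V : ∀ d .{{_ : NonZero d}} z L →
  2 ^ (d * (z ∸ 1)) ∸ cardV d z L ≡ count (not ∘ inV d z L) (allVecs (d * (z ∸ 1)))
2^N∸cardV≡count∁V d z L = begin
  2 ^ N ∸ cardV d z L                     ≡⟨ cong (_∸ cardV d z L) (length-allVecs N) ⟨
  length (allVecs N) ∸ cardV d z L        ≡⟨ cong (_∸ cardV d z L) (count-complement (inV d z L) (allVecs N)) ⟨
  cardV d z L + X ∸ cardV d z L           ≡⟨ m+n∸m≡n (cardV d z L) X ⟩
  X ∎
  where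
  open ≡-Reasoning
  N = d * (z ∸ 1)
  X = count (not ∘ inV d z L) (allVecs N)

^-distribʳ-* : ∀ a b k → (a * b) ^ k ≡ a ^ k * b ^ k
^-distribʳ-* a b zero = refl
^-distribʳ-* a b (suc k) = trans (cong (a * b *_) (^-distribʳ-* a b k)) (interchange a b (a ^ k) (b ^ k))

lemma5p1 : (d : ℕ) .{{_ : NonZero d}} (r z : ℕ) → 3 ≤ r → 2 ≤ z → z ≤ r ∸ 1 →
    (L : ℕ) → IsCeilLogSq z L →
    (n m : ℕ) → 1 ≤ m → 2 ^ n ≤ z ^ m →
    2 ^ (d * (n * n)) * (2 ^ (d * (z ∸ 1)) ∸ cardV d z L) ^ (m * m)
      ≤ (2 ^ suc (d * (z ∸ 1)) * z) ^ (m * m)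
lemma5p1 d _ z _ _ _ L (n²≤Lm² , _) n m 1≤m 2ⁿ≤zᵐ = begin
  2 ^ (d * (n * n)) * (2 ^ N ∸ cardV d z L) ^ K
    ≡⟨ cong (λ x → 2 ^ (d * (n * n)) * x ^ K) (2^N∸cardV≡count∁V d z L) ⟩
  2 ^ (d * (n * n)) * X ^ K ≤⟨ *-monoˡ-≤ (X ^ K) (^-monoʳ-≤ 2 (*-monoʳ-≤ d (n²≤Lm² n m 1≤m 2ⁿ≤zᵐ))) ⟩
  2 ^ (d * (L * K)) * X ^ K ≡⟨ cong (λ e → 2 ^ e * X ^ K) (*-assoc d L K) ⟨
  2 ^ (d * L * K) * X ^ K   ≡⟨ cong (_* X ^ K) (^-*-assoc 2 (d * L) K) ⟨
  (2 ^ (d * L)) ^ K * X ^ K ≡⟨ ^-distribʳ-* (2 ^ (d * L)) X K ⟨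
  (2 ^ (d * L) * X) ^ K     ≤⟨ ^-monoˡ-≤ K 2^dL*X≤2^[1+N]*z ⟩
  (2 ^ suc N * z) ^ K       ∎
  where
  open ≤-Reasoning
  N = d * (z ∸ 1)
  K = m * m
  X = count (not ∘ inV d z L) (allVecs N)
  2^dL*X≤2^[1+N]*z : 2 ^ (d * L) * X ≤ 2 ^ suc N * z
  2^dL*X≤2^[1+N]*z = begin
    2 ^ (d * L) * X  ≡⟨ *-comm (2 ^ (d * L)) X ⟩
    X * 2 ^ (d * L)  ≤⟨ ∁V-bound d z L ⟩
    (z ∸ L) * 2 ^ N  ≤⟨ *-monoˡ-≤ (2 ^ N) (m∸n≤m z L) ⟩
    z * 2 ^ N        ≡⟨ *-comm z (2 ^ N) ⟩
    2 ^ N * z        ≤⟨ *-monoˡ-≤ z (m≤m+n (2 ^ N) (2 ^ N + 0)) ⟩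
    2 ^ suc N * z    ∎
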